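{- For every $n\ge 0$ and every $k\ge 0$, the number of paths in $\mathcal M_n(UU)$ containing exactly $k$ occurrences of $DD$ equals the number of paths in $\mathcal M_{n+1}(UD)$ containing exactly $k$ occurrences of $DU$. In particular, $|\mathcal M_n(UU,DD)|=|\mathcal M_{n+1}(UD,DU)|$.
   Context: A Motzkin path of length $n$ is a lattice path from $(0,0)$ to $(n,0)$ with steps $U=(1,1)$, $F=(1,0)$, $D=(1,-1)$ that never goes below the $x$-axis, viewed as a word in $U,F,D$. An occurrence of a word $w$ in a path is a position where $w$ appears as a block of consecutive steps. $\mathcal M_n(w_1,\dots,w_r)$ denotes the set of Motzkin paths of length $n$ containing no occurrence of any of $w_1,\dots,w_r$. -}

module Defs where

open import Data.Nat using (ℕ; zero; suc; _+_)
open import Data.List using (List; []; _∷_; length; filter; concatMap; map)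
open import Data.Bool using (Bool; true; false; _∧_; T)
open import Data.Product using (_×_; _,_)
open import Relation.Nullary using (Dec; yes; no; ¬_)
open import Relation.Nullary.Decidable using (¬?; _×-dec_)
open import Relation.Binary.PropositionalEquality using (_≡_; refl)
open import Relation.Unary using (Decidable)

-- Steps U = (1,1), F = (1,0), D = (1,-1)
data Step : Set where
  U F D : Step

Word : Set
Word = List Step

_≟S_ : (a b : Step) → Dec (a ≡ b)
U ≟S U = yes refl
U ≟S F = no λ ()
U ≟S D = no λ ()
F ≟S U = no λ ()
F ≟S F = yes refl
F ≟S D = no λ ()
D ≟S U = no λ ()
D ≟S F = no λ ()
D ≟S D = yes refl

words : ℕ → List Word
words zero = [] ∷ []
words (suc n) = concatMap (λ w → (U ∷ w) ∷ (F ∷ w) ∷ (D ∷ w) ∷ []) (words n)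

isMotzkinFrom : ℕ → Word → Bool
isMotzkinFrom zero [] = true
isMotzkinFrom (suc _) [] = false
isMotzkinFrom h (U ∷ w) = isMotzkinFrom (suc h) w
isMotzkinFrom h (F ∷ w) = isMotzkinFrom h w
isMotzkinFrom zero (D ∷ w) = false
isMotzkinFrom (suc h) (D ∷ w) = isMotzkinFrom h w

IsMotzkin : Word → Set
IsMotzkin w = T (isMotzkinFrom 0 w)

isPrefix : Word → Word → Bool
isPrefix [] _ = true
isPrefix (_ ∷ _) [] = false
isPrefix (a ∷ w) (b ∷ p) with a ≟S b
... | yes _ = isPrefix w p
... | no _ = false

-- number of occurrences of w as a block of consecutive steps in p
-- (number of positions i with w a prefix of the suffix of p starting at i;
--  the empty word is never considered, w will be nonempty in uses)
occ : Word → Word → ℕ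
occ w [] = 0
occ w (a ∷ p) with isPrefix w (a ∷ p)
... | true = suc (occ w p)
... | false = occ w p

Avoids : Word → Word → Set
Avoids w p = occ w p ≡ 0

motzkin : ℕ → List Word
motzkin n = filter (λ p → T? (isMotzkinFrom 0 p)) (words n)
  where
    T? : (b : Bool) → Dec (T b)
    T? true = yes _
    T? false = no λ ()

countM : ℕ → (Word → Bool) → ℕ
countM n P = length (filter (λ p → T? (P p)) (motzkin n))
  where
    T? : (b : Bool) → Dec (T b)
    T? true = yes _
    T? false = no λ ()

isZero : ℕ → Bool
isZero zero = true
isZero (suc _) = false

_==ℕ_ : ℕ → ℕ → Bool
zero ==ℕ zero = true
zero ==ℕ suc _ = false
suc _ ==ℕ zero = false
suc m ==ℕ suc n = m ==ℕ n

-- Read a path step by step, remembering the previous step and the height, and record the number of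
-- occurrences of the counted pattern as the exponent of q.  Let uu m and ud m be the resulting
-- polynomials for UU-avoiding paths by DD and UD-avoiding paths by DU, uuD m that of the paths w D
-- (w ∈ M_m(UU)), and udAfterD m that of ud m when a D precedes the path.
-- Cutting a UU-avoiding path at its last return to the axis before the end gives
-- uu (m+1) = Σ_{i≤m} uu i · uuPrime (m+1−i), and likewise for uuD with uuPrimeD; a prime of length
-- at least 3 is U F w D, whence uuPrime (l+3) = uuD l and uuPrimeD (l+3) = q · uuD l.
-- Cutting a UD-avoiding path after its first step and, if that step is U, at its first return to the
-- axis gives ud (n+1) = udFrom1 n + ud n and udAfterD (n+1) = q · udFrom1 n + ud n with
-- udFrom1 (m+1) = Σ_{i<m} ud (i+1) · udAfterD (m−1−i), the elevated part being a nonempty UD-avoiding path.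
-- Comparing these recurrences, uu m = ud (m+1) and uuD m = udAfterD (m+1) by strong induction on m.

module Submission where

open import Defs
open import Data.Nat using (ℕ; zero; suc; _+_; _*_; _∸_; _≤_; _<_; z≤n; s≤s)
open import Data.Nat.Properties
open import Data.Nat.Induction using (<-rec)
open import Data.Nat.Tactic.RingSolver using (solve-∀)
open import Data.List using ([]; _∷_; length; take; drop; _++_; _∷ʳ_; filter; concatMap; map; fromMaybe)
open import Data.Nat.ListAction using (sum)
open import Data.Maybe using (Maybe; just; nothing; zipWith)
open import Data.Bool using (Bool; true; false; _∧_; if_then_else_; T)
open import Data.Bool.Properties using (∧-zeroʳ)
open import Data.Product using (_×_; _,_; proj₁; proj₂)
open import Data.Empty using (⊥-elim)
open import Relation.Nullary using (¬_; yes; no; Dec)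
open import Relation.Binary.PropositionalEquality
open ≡-Reasoning

iverson : Bool → ℕ
iverson true  = 1
iverson false = 0

∑< : ℕ → (ℕ → ℕ) → ℕ
∑< zero    f = 0
∑< (suc n) f = ∑< n f + f n

∑<-cong : ∀ n {f g : ℕ → ℕ} → (∀ i → i < n → f i ≡ g i) → ∑< n f ≡ ∑< n g
∑<-cong zero    f≡g = refl
∑<-cong (suc n) f≡g = cong₂ _+_ (∑<-cong n (λ i i<n → f≡g i (m<n⇒m<1+n i<n))) (f≡g n ≤-refl)

∑<-zero : ∀ n {f : ℕ → ℕ} → (∀ i → i < n → f i ≡ 0) → ∑< n f ≡ 0
∑<-zero zero    f≡0 = refl
∑<-zero (suc n) f≡0 = cong₂ _+_ (∑<-zero n (λ i i<n → f≡0 i (m<n⇒m<1+n i<n))) (f≡0 n ≤-refl)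

∑<-head : ∀ n (f : ℕ → ℕ) → ∑< (suc n) f ≡ f 0 + ∑< n (λ i → f (suc i))
∑<-head zero    f = +-comm 0 (f 0)
∑<-head (suc n) f = begin
  ∑< (suc n) f + f (suc n)                  ≡⟨ cong (_+ f (suc n)) (∑<-head n f) ⟩
  f 0 + ∑< n (λ i → f (suc i)) + f (suc n)  ≡⟨ +-assoc (f 0) _ _ ⟩
  f 0 + ∑< (suc n) (λ i → f (suc i))        ∎

δ : ℕ → ℕ → ℕ
δ m k = iverson (m ==ℕ k)

δ-refl : ∀ m → δ m m ≡ 1
δ-refl zero    = refl
δ-refl (suc m) = δ-refl m

δ-≢ : ∀ {m k} → m ≢ k → δ m k ≡ 0
δ-≢ {zero}  {zero}  m≢k = ⊥-elim (m≢k refl)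
δ-≢ {zero}  {suc k} m≢k = refl
δ-≢ {suc m} {zero}  m≢k = refl
δ-≢ {suc m} {suc k} m≢k = δ-≢ (λ m≡k → m≢k (cong suc m≡k))

δ-+ : ∀ a b {k} → a ≤ k → δ (a + b) k ≡ δ b (k ∸ a)
δ-+ zero    b {k}     _         = refl
δ-+ (suc a) b {suc k} (s≤s a≤k) = δ-+ a b a≤k

δ-+-> : ∀ a b {k} → k < a → δ (a + b) k ≡ 0
δ-+-> (suc a) b {zero}  _         = refl
δ-+-> (suc a) b {suc k} (s≤s k<a) = δ-+-> a b k<a

∑<-δ : ∀ n a (g : ℕ → ℕ) → a < n → ∑< n (λ i → δ a i * g i) ≡ g a
∑<-δ (suc n) a g a<1+n with a ≟ n
... | yes refl = begin
  ∑< a (λ i → δ a i * g i) + δ a a * g a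
    ≡⟨ cong₂ _+_ (∑<-zero a (λ i i<a → cong (_* g i) (δ-≢ (>⇒≢ i<a)))) (cong (_* g a) (δ-refl a)) ⟩
  0 + 1 * g a ≡⟨ +-identityʳ (g a) ⟩
  g a ∎
... | no a≢n = begin
  ∑< n (λ i → δ a i * g i) + δ a n * g n
    ≡⟨ cong₂ _+_ (∑<-δ n a g (≤∧≢⇒< (≤-pred a<1+n) a≢n)) (cong (_* g n) (δ-≢ a≢n)) ⟩
  g a + 0 ≡⟨ +-identityʳ (g a) ⟩
  g a ∎

∑<-δ-beyond : ∀ n a (g : ℕ → ℕ) → n ≤ a → ∑< n (λ i → δ a i * g i) ≡ 0
∑<-δ-beyond n a g n≤a = ∑<-zero n (λ i i<n → cong (_* g i) (δ-≢ (>⇒≢ (<-≤-trans i<n n≤a))))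

-- Polynomials in q are represented by their coefficient sequences.
_⋆_ : (ℕ → ℕ) → (ℕ → ℕ) → ℕ → ℕ
(P ⋆ Q) k = ∑< (suc k) (λ j → P j * Q (k ∸ j))

infixl 7 _⋆_

shift : (ℕ → ℕ) → ℕ → ℕ
shift P zero    = 0
shift P (suc k) = P k

shift-cong : ∀ {P Q} → P ≗ Q → shift P ≗ shift Q
shift-cong P≗Q zero    = refl
shift-cong P≗Q (suc k) = P≗Q k

⋆-cong : ∀ {P P′ Q Q′ : ℕ → ℕ} → P ≗ P′ → Q ≗ Q′ → P ⋆ Q ≗ P′ ⋆ Q′
⋆-cong P≗P′ Q≗Q′ k = ∑<-cong (suc k) (λ j _ → cong₂ _*_ (P≗P′ j) (Q≗Q′ (k ∸ j)))

⋆-identityˡ : ∀ Q → δ 0 ⋆ Q ≗ Q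
⋆-identityˡ Q k = begin
  ∑< (suc k) (λ j → δ 0 j * Q (k ∸ j)) ≡⟨ ∑<-head k _ ⟩
  Q k + 0 + ∑< k (λ j → 0)             ≡⟨ cong₂ _+_ (+-identityʳ (Q k)) (∑<-zero k (λ _ _ → refl)) ⟩
  Q k + 0                              ≡⟨ +-identityʳ (Q k) ⟩
  Q k                                  ∎

⋆-identityʳ : ∀ P → P ⋆ δ 0 ≗ P
⋆-identityʳ P k = begin
  ∑< (suc k) (λ j → P j * δ 0 (k ∸ j)) ≡⟨ ∑<-cong (suc k) (λ j j≤k → trans (*-comm (P j) _) (cong (_* P j) (δ0∸ k j (≤-pred j≤k)))) ⟩
  ∑< (suc k) (λ j → δ k j * P j)       ≡⟨ ∑<-δ (suc k) k P ≤-refl ⟩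
  P k                                  ∎
  where
  δ0∸ : ∀ k j → j ≤ k → δ 0 (k ∸ j) ≡ δ k j
  δ0∸ zero    zero    _         = refl
  δ0∸ (suc k) zero    _         = refl
  δ0∸ (suc k) (suc j) (s≤s j≤k) = δ0∸ k j j≤k

⋆-zeroˡ : ∀ {P} Q → P ≗ (λ _ → 0) → P ⋆ Q ≗ (λ _ → 0)
⋆-zeroˡ Q P≗0 k = ∑<-zero (suc k) (λ j _ → cong (_* Q (k ∸ j)) (P≗0 j))

⋆-zeroʳ : ∀ P {Q} → Q ≗ (λ _ → 0) → P ⋆ Q ≗ (λ _ → 0)
⋆-zeroʳ P Q≗0 k = ∑<-zero (suc k) (λ j _ → trans (cong (P j *_) (Q≗0 (k ∸ j))) (*-zeroʳ (P j)))

⋆-shiftʳ : ∀ P Q → P ⋆ shift Q ≗ shift (P ⋆ Q)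
⋆-shiftʳ P Q zero    = *-zeroʳ (P 0)
⋆-shiftʳ P Q (suc k) = begin
  ∑< (suc k) (λ j → P j * shift Q (suc k ∸ j)) + P (suc k) * shift Q (k ∸ k)
    ≡⟨ cong₂ _+_ (∑<-cong (suc k) (λ j j<1+k → cong (λ i → P j * shift Q i) (+-∸-assoc 1 (≤-pred j<1+k))))
                 (trans (cong (λ i → P (suc k) * shift Q i) (n∸n≡0 k)) (*-zeroʳ (P (suc k)))) ⟩
  (P ⋆ Q) k + 0 ≡⟨ +-identityʳ _ ⟩
  (P ⋆ Q) k     ∎

-- A statistic of a word is `just c` (the word is admissible and has value c) or `nothing`; as a polynomial it is the monomial q^c or 0.
_⊕_ : Maybe ℕ → Maybe ℕ → Maybe ℕ
_⊕_ = zipWith _+_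

infixr 6 _⊕_

coeff : ℕ → Maybe ℕ → ℕ
coeff k nothing  = 0
coeff k (just c) = δ c k

⊕-assoc : ∀ x y z → (x ⊕ y) ⊕ z ≡ x ⊕ (y ⊕ z)
⊕-assoc nothing  y        z        = refl
⊕-assoc (just a) nothing  z        = refl
⊕-assoc (just a) (just b) nothing  = refl
⊕-assoc (just a) (just b) (just c) = cong just (+-assoc a b c)

⊕-pull : ∀ c d x → just c ⊕ just d ⊕ x ≡ just (c + d) ⊕ x
⊕-pull c d x = sym (⊕-assoc (just c) (just d) x)

⊕-regroup : ∀ c d x y → just c ⊕ (just d ⊕ x) ⊕ y ≡ just (c + d) ⊕ x ⊕ y
⊕-regroup c d x y = trans (cong (just c ⊕_) (⊕-assoc (just d) x y)) (⊕-pull c d (x ⊕ y))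

⊕-comm : ∀ x y → x ⊕ y ≡ y ⊕ x
⊕-comm nothing  nothing  = refl
⊕-comm nothing  (just b) = refl
⊕-comm (just a) nothing  = refl
⊕-comm (just a) (just b) = cong just (+-comm a b)

⊕-identityˡ : ∀ x → just 0 ⊕ x ≡ x
⊕-identityˡ nothing  = refl
⊕-identityˡ (just a) = refl

coeff-⊕ : ∀ x y k → coeff k (x ⊕ y) ≡ ((λ j → coeff j x) ⋆ (λ j → coeff j y)) k
coeff-⊕ nothing  y        k = sym (∑<-zero (suc k) (λ _ _ → refl))
coeff-⊕ (just a) nothing  k = sym (∑<-zero (suc k) (λ i _ → *-zeroʳ (δ a i)))
coeff-⊕ (just a) (just b) k with a ≤? k
... | yes a≤k = trans (δ-+ a b a≤k) (sym (∑<-δ (suc k) a (λ j → δ b (k ∸ j)) (s≤s a≤k)))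
... | no a≰k  = trans (δ-+-> a b (≰⇒> a≰k)) (sym (∑<-δ-beyond (suc k) a (λ j → δ b (k ∸ j)) (≰⇒> a≰k)))

coeff-0⊕ : ∀ k x → coeff k (just 0 ⊕ x) ≡ coeff k x
coeff-0⊕ k x = cong (coeff k) (⊕-identityˡ x)

coeff-1⊕ : ∀ x k → coeff k (just 1 ⊕ x) ≡ shift (λ j → coeff j x) k
coeff-1⊕ nothing  zero    = refl
coeff-1⊕ (just a) zero    = refl
coeff-1⊕ nothing  (suc k) = refl
coeff-1⊕ (just a) (suc k) = refl

∑Word : ℕ → (Word → ℕ) → ℕ
∑Word zero    f = f []
∑Word (suc n) f = ∑Word n (λ w → f (U ∷ w)) + ∑Word n (λ w → f (F ∷ w)) + ∑Word n (λ w → f (D ∷ w))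

∑Word-cong : ∀ n {f g : Word → ℕ} → (∀ w → length w ≡ n → f w ≡ g w) → ∑Word n f ≡ ∑Word n g
∑Word-cong zero    f≡g = f≡g [] refl
∑Word-cong (suc n) f≡g =
  cong₂ _+_ (cong₂ _+_ (∑Word-cong n (λ w ∣w∣ → f≡g (U ∷ w) (cong suc ∣w∣)))
                       (∑Word-cong n (λ w ∣w∣ → f≡g (F ∷ w) (cong suc ∣w∣))))
            (∑Word-cong n (λ w ∣w∣ → f≡g (D ∷ w) (cong suc ∣w∣)))

∑Word-cong′ : ∀ n {f g : Word → ℕ} → f ≗ g → ∑Word n f ≡ ∑Word n g
∑Word-cong′ n f≗g = ∑Word-cong n (λ w _ → f≗g w)

∑Word-zero : ∀ n → ∑Word n (λ _ → 0) ≡ 0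
∑Word-zero zero = refl
∑Word-zero (suc n) rewrite ∑Word-zero n = refl

∑Word-+ : ∀ n (f g : Word → ℕ) → ∑Word n (λ w → f w + g w) ≡ ∑Word n f + ∑Word n g
∑Word-+ zero    f g = refl
∑Word-+ (suc n) f g
  rewrite ∑Word-+ n (λ w → f (U ∷ w)) (λ w → g (U ∷ w))
        | ∑Word-+ n (λ w → f (F ∷ w)) (λ w → g (F ∷ w))
        | ∑Word-+ n (λ w → f (D ∷ w)) (λ w → g (D ∷ w)) =
  regroup (∑Word n (λ w → f (U ∷ w))) (∑Word n (λ w → f (F ∷ w))) (∑Word n (λ w → f (D ∷ w)))
          (∑Word n (λ w → g (U ∷ w))) (∑Word n (λ w → g (F ∷ w))) (∑Word n (λ w → g (D ∷ w)))
  where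
  regroup : ∀ a b c d e f → a + d + (b + e) + (c + f) ≡ a + b + c + (d + e + f)
  regroup = solve-∀

∑Word-*ˡ : ∀ n c (f : Word → ℕ) → ∑Word n (λ w → c * f w) ≡ c * ∑Word n f
∑Word-*ˡ zero    c f = refl
∑Word-*ˡ (suc n) c f
  rewrite ∑Word-*ˡ n c (λ w → f (U ∷ w))
        | ∑Word-*ˡ n c (λ w → f (F ∷ w))
        | ∑Word-*ˡ n c (λ w → f (D ∷ w)) =
  distrib c (∑Word n (λ w → f (U ∷ w))) (∑Word n (λ w → f (F ∷ w))) (∑Word n (λ w → f (D ∷ w)))
  where
  distrib : ∀ c a b d → c * a + c * b + c * d ≡ c * (a + b + d)
  distrib = solve-∀

∑Word-∑< : ∀ n m (f : ℕ → Word → ℕ) → ∑Word n (λ w → ∑< m (λ i → f i w)) ≡ ∑< m (λ i → ∑Word n (f i))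
∑Word-∑< n zero    f = ∑Word-zero n
∑Word-∑< n (suc m) f = trans (∑Word-+ n (λ w → ∑< m (λ i → f i w)) (f m)) (cong (_+ ∑Word n (f m)) (∑Word-∑< n m f))

∑Word-∷ʳ : ∀ n (f : Word → ℕ) →
  ∑Word (suc n) f ≡ ∑Word n (λ u → f (u ∷ʳ U)) + ∑Word n (λ u → f (u ∷ʳ F)) + ∑Word n (λ u → f (u ∷ʳ D))
∑Word-∷ʳ zero    f = refl
∑Word-∷ʳ (suc n) f
  rewrite ∑Word-∷ʳ n (λ w → f (U ∷ w))
        | ∑Word-∷ʳ n (λ w → f (F ∷ w))
        | ∑Word-∷ʳ n (λ w → f (D ∷ w)) =
  transpose (∑Word n (λ w → f (U ∷ (w ∷ʳ U)))) (∑Word n (λ w → f (U ∷ (w ∷ʳ F)))) (∑Word n (λ w → f (U ∷ (w ∷ʳ D))))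
            (∑Word n (λ w → f (F ∷ (w ∷ʳ U)))) (∑Word n (λ w → f (F ∷ (w ∷ʳ F)))) (∑Word n (λ w → f (F ∷ (w ∷ʳ D))))
            (∑Word n (λ w → f (D ∷ (w ∷ʳ U)))) (∑Word n (λ w → f (D ∷ (w ∷ʳ F)))) (∑Word n (λ w → f (D ∷ (w ∷ʳ D))))
  where
  transpose : ∀ a b c d e f g h i → a + b + c + (d + e + f) + (g + h + i) ≡ a + d + g + (b + e + h) + (c + f + i)
  transpose = solve-∀

∑Word-take-drop : ∀ m n (f g : Word → ℕ) → ∑Word (m + n) (λ w → f (take m w) * g (drop m w)) ≡ ∑Word m f * ∑Word n g
∑Word-take-drop zero    n f g = ∑Word-*ˡ n (f []) g
∑Word-take-drop (suc m) n f g
  rewrite ∑Word-take-drop m n (λ w → f (U ∷ w)) g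
        | ∑Word-take-drop m n (λ w → f (F ∷ w)) g
        | ∑Word-take-drop m n (λ w → f (D ∷ w)) g =
  distrib (∑Word n g) (∑Word m (λ w → f (U ∷ w))) (∑Word m (λ w → f (F ∷ w))) (∑Word m (λ w → f (D ∷ w)))
  where
  distrib : ∀ c a b d → a * c + b * c + d * c ≡ (a + b + d) * c
  distrib = solve-∀

dist : ℕ → (Word → Maybe ℕ) → ℕ → ℕ
dist n X k = ∑Word n (λ w → coeff k (X w))

dist-cong : ∀ n {X Y : Word → Maybe ℕ} → X ≗ Y → dist n X ≗ dist n Y
dist-cong n X≗Y k = ∑Word-cong′ n (λ w → cong (coeff k) (X≗Y w))

dist-split : ∀ n i (X Y : Word → Maybe ℕ) → i ≤ n → ∀ k →
  ∑Word n (λ w → coeff k (X (take i w) ⊕ Y (drop i w))) ≡ (dist i X ⋆ dist (n ∸ i) Y) k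
dist-split n i X Y i≤n k = begin
  ∑Word n (λ w → coeff k (X (take i w) ⊕ Y (drop i w)))
    ≡⟨ cong (λ m → ∑Word m (λ w → coeff k (X (take i w) ⊕ Y (drop i w)))) (sym (m+[n∸m]≡n i≤n)) ⟩
  ∑Word (i + (n ∸ i)) (λ w → coeff k (X (take i w) ⊕ Y (drop i w)))
    ≡⟨ ∑Word-cong′ (i + (n ∸ i)) (λ w → coeff-⊕ (X (take i w)) (Y (drop i w)) k) ⟩
  ∑Word (i + (n ∸ i)) (λ w → ∑< (suc k) (λ j → coeff j (X (take i w)) * coeff (k ∸ j) (Y (drop i w))))
    ≡⟨ ∑Word-∑< (i + (n ∸ i)) (suc k) _ ⟩
  ∑< (suc k) (λ j → ∑Word (i + (n ∸ i)) (λ w → coeff j (X (take i w)) * coeff (k ∸ j) (Y (drop i w))))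
    ≡⟨ ∑<-cong (suc k) (λ j _ → ∑Word-take-drop i (n ∸ i) (λ u → coeff j (X u)) (λ v → coeff (k ∸ j) (Y v))) ⟩
  (dist i X ⋆ dist (n ∸ i) Y) k ∎

length-filter : ∀ (Q : Word → Bool) (Q? : ∀ w → Dec (T (Q w))) xs →
  length (filter Q? xs) ≡ sum (map (λ w → iverson (Q w)) xs)
length-filter Q Q? []       = refl
length-filter Q Q? (x ∷ xs) with Q x | Q? x
... | true  | yes _  = cong suc (length-filter Q Q? xs)
... | true  | no ¬t  = ⊥-elim (¬t _)
... | false | no _   = length-filter Q Q? xs

sum-map-filter : ∀ (M : Word → Bool) (M? : ∀ w → Dec (T (M w))) g xs →
  sum (map g (filter M? xs)) ≡ sum (map (λ w → if M w then g w else 0) xs)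
sum-map-filter M M? g []       = refl
sum-map-filter M M? g (x ∷ xs) with M x | M? x
... | true  | yes _  = cong (g x +_) (sum-map-filter M M? g xs)
... | true  | no ¬t  = ⊥-elim (¬t _)
... | false | no _   = sum-map-filter M M? g xs

sum-map-words : ∀ n g → sum (map g (words n)) ≡ ∑Word n g
sum-map-words zero    g = +-identityʳ (g [])
sum-map-words (suc n) g = begin
  sum (map g (words (suc n)))
    ≡⟨ byFirstStep (words n) ⟩
  sum (map (λ w → g (U ∷ w) + g (F ∷ w) + g (D ∷ w)) (words n))
    ≡⟨ sum-map-words n _ ⟩
  ∑Word n (λ w → g (U ∷ w) + g (F ∷ w) + g (D ∷ w))
    ≡⟨ ∑Word-+ n _ _ ⟩
  ∑Word n (λ w → g (U ∷ w) + g (F ∷ w)) + ∑Word n (λ w → g (D ∷ w))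
    ≡⟨ cong (_+ ∑Word n (λ w → g (D ∷ w))) (∑Word-+ n _ _) ⟩
  ∑Word (suc n) g ∎
  where
  byFirstStep : ∀ xs → sum (map g (concatMap (λ w → (U ∷ w) ∷ (F ∷ w) ∷ (D ∷ w) ∷ []) xs))
                     ≡ sum (map (λ w → g (U ∷ w) + g (F ∷ w) + g (D ∷ w)) xs)
  byFirstStep []       = refl
  byFirstStep (x ∷ xs) = trans (cong (λ r → g (U ∷ x) + (g (F ∷ x) + (g (D ∷ x) + r))) (byFirstStep xs))
                               (reassoc (g (U ∷ x)) (g (F ∷ x)) (g (D ∷ x)) _)
    where
    reassoc : ∀ a b c r → a + (b + (c + r)) ≡ a + b + c + r
    reassoc = solve-∀

countM-∑Word : ∀ n (P : Word → Bool) → countM n P ≡ ∑Word n (λ w → iverson (isMotzkinFrom 0 w ∧ P w))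
countM-∑Word n P = begin
  countM n P
    ≡⟨ length-filter P _ (motzkin n) ⟩
  sum (map (λ w → iverson (P w)) (motzkin n))
    ≡⟨ sum-map-filter (isMotzkinFrom 0) _ _ (words n) ⟩
  sum (map (λ w → if isMotzkinFrom 0 w then iverson (P w) else 0) (words n))
    ≡⟨ sum-map-words n _ ⟩
  ∑Word n (λ w → if isMotzkinFrom 0 w then iverson (P w) else 0)
    ≡⟨ ∑Word-cong′ n (λ w → iverson-∧ (isMotzkinFrom 0 w) (P w)) ⟩
  ∑Word n (λ w → iverson (isMotzkinFrom 0 w ∧ P w)) ∎
  where
  iverson-∧ : ∀ a b → (if a then iverson b else 0) ≡ iverson (a ∧ b)
  iverson-∧ true  b = refl
  iverson-∧ false b = refl

countM-cong : ∀ n {P Q : Word → Bool} → P ≗ Q → countM n P ≡ countM n Q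
countM-cong n {P} {Q} P≗Q = begin
  countM n P ≡⟨ countM-∑Word n P ⟩
  ∑Word n (λ w → iverson (isMotzkinFrom 0 w ∧ P w)) ≡⟨ ∑Word-cong′ n (λ w → cong (λ b → iverson (isMotzkinFrom 0 w ∧ b)) (P≗Q w)) ⟩
  ∑Word n (λ w → iverson (isMotzkinFrom 0 w ∧ Q w)) ≡⟨ sym (countM-∑Word n Q) ⟩
  countM n Q ∎

hit : Step → Step → Maybe Step → Step → Bool
hit x y nothing  b = false
hit x y (just a) b = isPrefix (x ∷ y ∷ []) (a ∷ b ∷ [])

isPrefix-pair : ∀ x y a b w → isPrefix (x ∷ y ∷ []) (a ∷ b ∷ w) ≡ isPrefix (x ∷ y ∷ []) (a ∷ b ∷ [])
isPrefix-pair x y a b w with x ≟S a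
... | no _ = refl
... | yes _ with y ≟S b
...   | yes _ = refl
...   | no _  = refl

occ-pair-[] : ∀ x y p → occ (x ∷ y ∷ []) (fromMaybe p ++ []) ≡ 0
occ-pair-[] x y nothing  = refl
occ-pair-[] x y (just a) with x ≟S a
... | yes _ = refl
... | no _  = refl

occ-pair-∷ : ∀ x y p b w → occ (x ∷ y ∷ []) (fromMaybe p ++ b ∷ w) ≡ iverson (hit x y p b) + occ (x ∷ y ∷ []) (b ∷ w)
occ-pair-∷ x y nothing  b w = refl
occ-pair-∷ x y (just a) b w rewrite isPrefix-pair x y a b w with isPrefix (x ∷ y ∷ []) (a ∷ b ∷ [])
... | true  = refl
... | false = refl

-- Reading a word from a state (previous step, height), rejecting the forbidden pattern f₁ f₂ and
-- negative heights, and counting the occurrences of the pattern c₁ c₂.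
module Automaton (f₁ f₂ c₁ c₂ : Step) where

  advance : ℕ → Step → ℕ → Maybe (ℕ × ℕ)
  advance h       U c = just (suc h , c)
  advance h       F c = just (h , c)
  advance zero    D c = nothing
  advance (suc h) D c = just (h , c)

  transition : Maybe Step → ℕ → Step → Maybe (ℕ × ℕ)
  transition p h a = if hit f₁ f₂ p a then nothing else advance h a (iverson (hit c₁ c₂ p a))

  continue : (ℕ → Maybe ℕ) → Maybe (ℕ × ℕ) → Maybe ℕ
  continue k nothing         = nothing
  continue k (just (h′ , c)) = just c ⊕ k h′

  Acceptor : Set
  Acceptor = Maybe Step → Maybe ℕ

  run : Acceptor → Maybe Step → ℕ → Word → Maybe ℕ
  run acc p h       (a ∷ w) = continue (λ h′ → run acc (just a) h′ w) (transition p h a)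
  run acc p zero    []      = acc p
  run acc p (suc h) []      = nothing

  atEnd : Acceptor → Maybe Step → Word → Maybe ℕ
  atEnd acc q []      = acc q
  atEnd acc q (_ ∷ _) = nothing

  -- Like run, but the word must reach height 0 only at its very end, after at least one step.
  mutual
    firstPassage : Acceptor → Maybe Step → ℕ → Word → Maybe ℕ
    firstPassage acc p h []      = nothing
    firstPassage acc p h (a ∷ w) = continue (λ h′ → firstPassageAt acc (just a) h′ w) (transition p h a)

    firstPassageAt : Acceptor → Maybe Step → ℕ → Word → Maybe ℕ
    firstPassageAt acc q zero    w = atEnd acc q w
    firstPassageAt acc q (suc h) w = firstPassage acc q (suc h) w

  accept₀ : Acceptor
  accept₀ _ = just 0

  appendD : Acceptor → Acceptor
  appendD acc q = if hit f₁ f₂ q D then nothing else just (iverson (hit c₁ c₂ q D)) ⊕ acc (just D)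

  mutual
    coeff-run-accept₀ : ∀ p h c k w →
      coeff k (just c ⊕ run accept₀ p h w)
        ≡ iverson (isMotzkinFrom h w ∧ (isZero (occ (f₁ ∷ f₂ ∷ []) (fromMaybe p ++ w))
                                       ∧ ((c + occ (c₁ ∷ c₂ ∷ []) (fromMaybe p ++ w)) ==ℕ k)))
    coeff-run-accept₀ p zero    c k [] rewrite occ-pair-[] f₁ f₂ p | occ-pair-[] c₁ c₂ p = refl
    coeff-run-accept₀ p (suc h) c k [] = refl
    coeff-run-accept₀ p h c k (b ∷ w) rewrite occ-pair-∷ f₁ f₂ p b w | occ-pair-∷ c₁ c₂ p b w
      with hit f₁ f₂ p b | hit c₁ c₂ p b
    ... | true  | _ = sym (cong iverson (∧-zeroʳ (isMotzkinFrom h (b ∷ w))))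
    coeff-run-accept₀ p zero    c k (U ∷ w) | false | hc = coeff-run-accept₀-step U 1 c (iverson hc) k w
    coeff-run-accept₀ p (suc h) c k (U ∷ w) | false | hc = coeff-run-accept₀-step U (suc (suc h)) c (iverson hc) k w
    coeff-run-accept₀ p zero    c k (F ∷ w) | false | hc = coeff-run-accept₀-step F zero c (iverson hc) k w
    coeff-run-accept₀ p (suc h) c k (F ∷ w) | false | hc = coeff-run-accept₀-step F (suc h) c (iverson hc) k w
    coeff-run-accept₀ p zero    c k (D ∷ w) | false | hc = refl
    coeff-run-accept₀ p (suc h) c k (D ∷ w) | false | hc = coeff-run-accept₀-step D h c (iverson hc) k w

    coeff-run-accept₀-step : ∀ b h′ c d k w →
      coeff k (just c ⊕ (just d ⊕ run accept₀ (just b) h′ w))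
        ≡ iverson (isMotzkinFrom h′ w ∧ (isZero (occ (f₁ ∷ f₂ ∷ []) (b ∷ w))
                                        ∧ ((c + (d + occ (c₁ ∷ c₂ ∷ []) (b ∷ w))) ==ℕ k)))
    coeff-run-accept₀-step b h′ c d k w = begin
      coeff k (just c ⊕ (just d ⊕ run accept₀ (just b) h′ w))
        ≡⟨ cong (coeff k) (⊕-pull c d (run accept₀ (just b) h′ w)) ⟩
      coeff k (just (c + d) ⊕ run accept₀ (just b) h′ w)
        ≡⟨ coeff-run-accept₀ (just b) h′ (c + d) k w ⟩
      iverson (isMotzkinFrom h′ w ∧ (isZero (occ (f₁ ∷ f₂ ∷ []) (b ∷ w))
                                    ∧ ((c + d + occ (c₁ ∷ c₂ ∷ []) (b ∷ w)) ==ℕ k)))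
        ≡⟨ cong (λ n → iverson (isMotzkinFrom h′ w ∧ (isZero (occ (f₁ ∷ f₂ ∷ []) (b ∷ w)) ∧ (n ==ℕ k)))) (+-assoc c d _) ⟩
      iverson (isMotzkinFrom h′ w ∧ (isZero (occ (f₁ ∷ f₂ ∷ []) (b ∷ w))
                                    ∧ ((c + (d + occ (c₁ ∷ c₂ ∷ []) (b ∷ w))) ==ℕ k))) ∎

  transition-to-0 : ∀ {p h b d} → transition p (suc h) b ≡ just (0 , d) → b ≡ D
  transition-to-0 {p} {h} {b} eq with hit f₁ f₂ p b
  transition-to-0 {b = U} () | false
  transition-to-0 {b = F} () | false
  transition-to-0 {b = D} eq | false = refl

  transition-to-0-notU : ∀ {p h b d} → transition p h b ≡ just (0 , d) → b ≢ U
  transition-to-0-notU {p} {h} {b} eq with hit f₁ f₂ p b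
  transition-to-0-notU {b = U} () | false
  transition-to-0-notU {b = F} eq | false = λ ()
  transition-to-0-notU {b = D} eq | false = λ ()

  -- Only the split at the first time height 0 is reached contributes.
  run-split-firstPassage : ∀ acc p h c k w →
    coeff k (just c ⊕ run acc p (suc h) w)
      ≡ ∑< (suc (length w)) (λ i → coeff k (just c ⊕ firstPassage accept₀ p (suc h) (take i w) ⊕ run acc (just D) 0 (drop i w)))
  run-split-firstPassage acc p h c k []      = refl
  run-split-firstPassage acc p h c k (b ∷ w) =
    trans (byFirstStep b (transition p (suc h) b) refl) (sym (∑<-head (suc (length w)) _))
    where
    byFirstStep : ∀ b r → transition p (suc h) b ≡ r →
      coeff k (just c ⊕ continue (λ h′ → run acc (just b) h′ w) r)
        ≡ ∑< (suc (length w)) (λ i → coeff k (just c ⊕ continue (λ h′ → firstPassageAt accept₀ (just b) h′ (take i w)) r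
                                                       ⊕ run acc (just D) 0 (drop i w)))
    byFirstStep b nothing _ = sym (∑<-zero (suc (length w)) (λ _ _ → refl))
    byFirstStep b (just (suc h′ , d)) _ = begin
      coeff k (just c ⊕ just d ⊕ run acc (just b) (suc h′) w)
        ≡⟨ cong (coeff k) (⊕-pull c d (run acc (just b) (suc h′) w)) ⟩
      coeff k (just (c + d) ⊕ run acc (just b) (suc h′) w)
        ≡⟨ run-split-firstPassage acc (just b) h′ (c + d) k w ⟩
      ∑< (suc (length w)) (λ i → coeff k (just (c + d) ⊕ firstPassage accept₀ (just b) (suc h′) (take i w) ⊕ run acc (just D) 0 (drop i w)))
        ≡⟨ ∑<-cong (suc (length w)) (λ i _ → cong (coeff k)
             (sym (⊕-regroup c d (firstPassage accept₀ (just b) (suc h′) (take i w)) (run acc (just D) 0 (drop i w))))) ⟩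
      ∑< (suc (length w)) (λ i → coeff k (just c ⊕ (just d ⊕ firstPassage accept₀ (just b) (suc h′) (take i w)) ⊕ run acc (just D) 0 (drop i w))) ∎
    byFirstStep b (just (zero , d)) eq with transition-to-0 {p} {h} {b} eq
    ... | refl = begin
      coeff k (just c ⊕ just d ⊕ run acc (just D) 0 w)
        ≡⟨ cong (λ x → coeff k (just c ⊕ x)) (sym (dropZero (run acc (just D) 0 w))) ⟩
      coeff k (just c ⊕ (just d ⊕ just 0) ⊕ run acc (just D) 0 w)
        ≡⟨ sym (+-identityʳ _) ⟩
      coeff k (just c ⊕ (just d ⊕ just 0) ⊕ run acc (just D) 0 w) + 0
        ≡⟨ cong (coeff k (just c ⊕ (just d ⊕ just 0) ⊕ run acc (just D) 0 w) +_) (sym (laterTerms w)) ⟩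
      coeff k (just c ⊕ (just d ⊕ just 0) ⊕ run acc (just D) 0 w)
        + ∑< (length w) (λ i → coeff k (just c ⊕ (just d ⊕ atEnd accept₀ (just D) (take (suc i) w)) ⊕ run acc (just D) 0 (drop (suc i) w)))
        ≡⟨ sym (∑<-head (length w) _) ⟩
      ∑< (suc (length w)) (λ i → coeff k (just c ⊕ (just d ⊕ atEnd accept₀ (just D) (take i w)) ⊕ run acc (just D) 0 (drop i w))) ∎
      where
      dropZero : ∀ x → (just d ⊕ just 0) ⊕ x ≡ just d ⊕ x
      dropZero x = trans (⊕-assoc (just d) (just 0) x) (cong (just d ⊕_) (⊕-identityˡ x))
      laterTerms : ∀ w → ∑< (length w) (λ i → coeff k (just c ⊕ (just d ⊕ atEnd accept₀ (just D) (take (suc i) w)) ⊕ run acc (just D) 0 (drop (suc i) w))) ≡ 0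
      laterTerms []      = refl
      laterTerms (_ ∷ w) = ∑<-zero (suc (length w)) (λ _ _ → refl)

  -- Only the split at the last visit of height 0 before the end contributes, or none if there is no such visit.
  run-split-lastVisit : ∀ acc → (∀ a w → a ≢ U → firstPassage acc (just a) 0 w ≡ firstPassage acc nothing 0 w) →
    ∀ p h c k b w →
    coeff k (just c ⊕ run acc p h (b ∷ w))
      ≡ coeff k (just c ⊕ firstPassage acc p h (b ∷ w))
        + ∑< (suc (length w)) (λ j → coeff k (just c ⊕ run accept₀ p h (b ∷ take j w) ⊕ firstPassage acc nothing 0 (drop j w)))
  run-split-lastVisit acc prev-irrelevant p h c k b w = byFirstStep b w (transition p h b) refl
    where
    prime : Word → Maybe ℕ
    prime = firstPassage acc nothing 0

    afterStep : ∀ b h′ d b′ w →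
      coeff k (just c ⊕ just d ⊕ run acc (just b) h′ (b′ ∷ w))
        ≡ coeff k (just (c + d) ⊕ firstPassage acc (just b) h′ (b′ ∷ w))
          + ∑< (suc (length w)) (λ j → coeff k (just c ⊕ (just d ⊕ run accept₀ (just b) h′ (b′ ∷ take j w)) ⊕ prime (drop j w)))
    afterStep b h′ d b′ w = begin
      coeff k (just c ⊕ just d ⊕ run acc (just b) h′ (b′ ∷ w))
        ≡⟨ cong (coeff k) (⊕-pull c d (run acc (just b) h′ (b′ ∷ w))) ⟩
      coeff k (just (c + d) ⊕ run acc (just b) h′ (b′ ∷ w))
        ≡⟨ run-split-lastVisit acc prev-irrelevant (just b) h′ (c + d) k b′ w ⟩
      coeff k (just (c + d) ⊕ firstPassage acc (just b) h′ (b′ ∷ w))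
        + ∑< (suc (length w)) (λ j → coeff k (just (c + d) ⊕ run accept₀ (just b) h′ (b′ ∷ take j w) ⊕ prime (drop j w)))
        ≡⟨ cong (coeff k (just (c + d) ⊕ firstPassage acc (just b) h′ (b′ ∷ w)) +_) (∑<-cong (suc (length w)) (λ j _ →
             cong (coeff k) (sym (⊕-regroup c d (run accept₀ (just b) h′ (b′ ∷ take j w)) (prime (drop j w)))))) ⟩
      coeff k (just (c + d) ⊕ firstPassage acc (just b) h′ (b′ ∷ w))
        + ∑< (suc (length w)) (λ j → coeff k (just c ⊕ (just d ⊕ run accept₀ (just b) h′ (b′ ∷ take j w)) ⊕ prime (drop j w))) ∎

    byFirstStep : ∀ b w r → transition p h b ≡ r →
      coeff k (just c ⊕ continue (λ h′ → run acc (just b) h′ w) r)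
        ≡ coeff k (just c ⊕ continue (λ h′ → firstPassageAt acc (just b) h′ w) r)
          + ∑< (suc (length w)) (λ j → coeff k (just c ⊕ continue (λ h′ → run accept₀ (just b) h′ (take j w)) r ⊕ prime (drop j w)))
    byFirstStep b w        nothing             _  = sym (∑<-zero (suc (length w)) (λ _ _ → refl))
    byFirstStep b []       (just (zero , d))   _  = sym (+-identityʳ _)
    byFirstStep b []       (just (suc h′ , d)) _  = refl
    byFirstStep b (b′ ∷ w) (just (zero , d))   eq =
      trans (afterStep b 0 d b′ w) (trans (cong (_+ laterVisits) (cong (coeff k) lastVisitHere)) (sym (∑<-head (suc (length w)) _)))
      where
      laterVisits : ℕ
      laterVisits = ∑< (suc (length w)) (λ j → coeff k (just c ⊕ (just d ⊕ run accept₀ (just b) 0 (b′ ∷ take j w)) ⊕ prime (drop j w)))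
      lastVisitHere : just (c + d) ⊕ firstPassage acc (just b) 0 (b′ ∷ w) ≡ just c ⊕ (just d ⊕ just 0) ⊕ prime (b′ ∷ w)
      lastVisitHere = begin
        just (c + d) ⊕ firstPassage acc (just b) 0 (b′ ∷ w)
          ≡⟨ cong (just (c + d) ⊕_) (prev-irrelevant b (b′ ∷ w) (transition-to-0-notU {p} {h} {b} eq)) ⟩
        just (c + d) ⊕ prime (b′ ∷ w)
          ≡⟨ cong (λ n → just (c + n) ⊕ prime (b′ ∷ w)) (sym (+-identityʳ d)) ⟩
        just (c + (d + 0)) ⊕ prime (b′ ∷ w)
          ≡⟨ sym (⊕-pull c (d + 0) (prime (b′ ∷ w))) ⟩
        just c ⊕ (just d ⊕ just 0) ⊕ prime (b′ ∷ w) ∎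
    byFirstStep b (b′ ∷ w) (just (suc h′ , d)) _ =
      trans (afterStep b (suc h′) d b′ w)
            (cong₂ _+_ (cong (coeff k) (sym (⊕-pull c d (firstPassage acc (just b) (suc h′) (b′ ∷ w)))))
                       (sym (∑<-head (suc (length w)) _)))

  -- A first passage from height h + 1 ends with D; reading it without that D is a run one level lower.
  firstPassage-∷ʳD : ∀ acc p h u → firstPassage acc p (suc h) (u ∷ʳ D) ≡ run (appendD acc) p h u
  firstPassage-∷ʳD acc p zero [] with hit f₁ f₂ p D
  ... | true  = refl
  ... | false = refl
  firstPassage-∷ʳD acc p (suc h) [] with hit f₁ f₂ p D
  ... | true  = refl
  ... | false = refl
  firstPassage-∷ʳD acc p h (b ∷ u) with hit f₁ f₂ p b | hit c₁ c₂ p b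
  ... | true | _ = refl
  firstPassage-∷ʳD acc p h       (U ∷ u)     | false | hc = cong (just (iverson hc) ⊕_) (firstPassage-∷ʳD acc (just U) (suc h) u)
  firstPassage-∷ʳD acc p h       (F ∷ u)     | false | hc = cong (just (iverson hc) ⊕_) (firstPassage-∷ʳD acc (just F) h u)
  firstPassage-∷ʳD acc p zero    (D ∷ [])    | false | hc = refl
  firstPassage-∷ʳD acc p zero    (D ∷ _ ∷ u) | false | hc = refl
  firstPassage-∷ʳD acc p (suc h) (D ∷ u)     | false | hc = cong (just (iverson hc) ⊕_) (firstPassage-∷ʳD acc (just D) h u)

  firstPassage-∷ʳ-notD : ∀ acc p h u a → a ≢ D → firstPassage acc p (suc h) (u ∷ʳ a) ≡ nothing
  firstPassage-∷ʳ-notD acc p h [] a a≢D with hit f₁ f₂ p a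
  ... | true = refl
  firstPassage-∷ʳ-notD acc p h [] U a≢D | false = refl
  firstPassage-∷ʳ-notD acc p h [] F a≢D | false = refl
  firstPassage-∷ʳ-notD acc p h [] D a≢D | false = ⊥-elim (a≢D refl)
  firstPassage-∷ʳ-notD acc p h (b ∷ u) a a≢D with hit f₁ f₂ p b | hit c₁ c₂ p b
  ... | true | _ = refl
  firstPassage-∷ʳ-notD acc p h       (U ∷ u)     a a≢D | false | hc = cong (just (iverson hc) ⊕_) (firstPassage-∷ʳ-notD acc (just U) (suc h) u a a≢D)
  firstPassage-∷ʳ-notD acc p h       (F ∷ u)     a a≢D | false | hc = cong (just (iverson hc) ⊕_) (firstPassage-∷ʳ-notD acc (just F) h u a a≢D)
  firstPassage-∷ʳ-notD acc p zero    (D ∷ [])    a a≢D | false | hc = refl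
  firstPassage-∷ʳ-notD acc p zero    (D ∷ _ ∷ u) a a≢D | false | hc = refl
  firstPassage-∷ʳ-notD acc p (suc h) (D ∷ u)     a a≢D | false | hc = cong (just (iverson hc) ⊕_) (firstPassage-∷ʳ-notD acc (just D) h u a a≢D)

  dist-firstPassage : ∀ acc p h n → dist (suc n) (firstPassage acc p (suc h)) ≗ dist n (run (appendD acc) p h)
  dist-firstPassage acc p h n k = begin
    dist (suc n) (firstPassage acc p (suc h)) k
      ≡⟨ ∑Word-∷ʳ n (λ w → coeff k (firstPassage acc p (suc h) w)) ⟩
    ∑Word n (λ u → coeff k (firstPassage acc p (suc h) (u ∷ʳ U))) + ∑Word n (λ u → coeff k (firstPassage acc p (suc h) (u ∷ʳ F)))
      + ∑Word n (λ u → coeff k (firstPassage acc p (suc h) (u ∷ʳ D)))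
      ≡⟨ cong₂ _+_ (cong₂ _+_ (vanishes U (λ ())) (vanishes F (λ ()))) (∑Word-cong′ n (λ u → cong (coeff k) (firstPassage-∷ʳD acc p h u))) ⟩
    dist n (run (appendD acc) p h) k ∎
    where
    vanishes : ∀ a → a ≢ D → ∑Word n (λ u → coeff k (firstPassage acc p (suc h) (u ∷ʳ a))) ≡ 0
    vanishes a a≢D = trans (∑Word-cong′ n (λ u → cong (coeff k) (firstPassage-∷ʳ-notD acc p h u a a≢D))) (∑Word-zero n)

  run-cong : ∀ {acc acc′ : Acceptor} → acc ≗ acc′ → ∀ p h w → run acc p h w ≡ run acc′ p h w
  run-cong acc≗acc′ p zero    []      = acc≗acc′ p
  run-cong acc≗acc′ p (suc h) []      = refl
  run-cong acc≗acc′ p h       (b ∷ w) with transition p h b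
  ... | nothing       = refl
  ... | just (h′ , d) = cong (just d ⊕_) (run-cong acc≗acc′ (just b) h′ w)

  run-⊕ʳ : ∀ acc e p h w → run (λ q → acc q ⊕ just e) p h w ≡ run acc p h w ⊕ just e
  run-⊕ʳ acc e p zero    []      = refl
  run-⊕ʳ acc e p (suc h) []      = refl
  run-⊕ʳ acc e p h       (b ∷ w) with transition p h b
  ... | nothing       = refl
  ... | just (h′ , d) = trans (cong (just d ⊕_) (run-⊕ʳ acc e (just b) h′ w)) (sym (⊕-assoc (just d) (run acc (just b) h′ w) (just e)))

  countM-dist : ∀ n k →
    countM n (λ w → isZero (occ (f₁ ∷ f₂ ∷ []) w) ∧ (occ (c₁ ∷ c₂ ∷ []) w ==ℕ k)) ≡ dist n (run accept₀ nothing 0) k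
  countM-dist n k = trans (countM-∑Word n _) (∑Word-cong′ n (λ w → begin
    iverson (isMotzkinFrom 0 w ∧ (isZero (occ (f₁ ∷ f₂ ∷ []) w) ∧ (occ (c₁ ∷ c₂ ∷ []) w ==ℕ k)))
      ≡⟨ sym (coeff-run-accept₀ nothing 0 0 k w) ⟩
    coeff k (just 0 ⊕ run accept₀ nothing 0 w)
      ≡⟨ coeff-0⊕ k (run accept₀ nothing 0 w) ⟩
    coeff k (run accept₀ nothing 0 w) ∎))

module L = Automaton U U D D
module R = Automaton U D D U

uu uuD uuPrime uuPrimeD : ℕ → ℕ → ℕ
uu       n = dist n (L.run L.accept₀ nothing 0)
uuD      n = dist n (L.run (L.appendD L.accept₀) nothing 0)
uuPrime  n = dist n (L.firstPassage L.accept₀ nothing 0)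
uuPrimeD n = dist n (L.firstPassage (L.appendD L.accept₀) nothing 0)

L-firstPassage-prev : ∀ acc a w → a ≢ U → L.firstPassage acc (just a) 0 w ≡ L.firstPassage acc nothing 0 w
L-firstPassage-prev acc U w       a≢U = ⊥-elim (a≢U refl)
L-firstPassage-prev acc F []      _   = refl
L-firstPassage-prev acc F (U ∷ w) _   = refl
L-firstPassage-prev acc F (F ∷ w) _   = refl
L-firstPassage-prev acc F (D ∷ w) _   = refl
L-firstPassage-prev acc D []      _   = refl
L-firstPassage-prev acc D (U ∷ w) _   = refl
L-firstPassage-prev acc D (F ∷ w) _   = refl
L-firstPassage-prev acc D (D ∷ w) _   = refl

L-run-afterF : ∀ acc → acc (just F) ≡ acc nothing → ∀ w → L.run acc (just F) 0 w ≡ L.run acc nothing 0 w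
L-run-afterF acc eq []      = eq
L-run-afterF acc eq (U ∷ w) = refl
L-run-afterF acc eq (F ∷ w) = refl
L-run-afterF acc eq (D ∷ w) = refl

uu-lastVisit : ∀ acc m k →
  dist (suc m) (L.run acc nothing 0) k ≡ ∑< (suc m) (λ i → (uu i ⋆ dist (suc m ∸ i) (L.firstPassage acc nothing 0)) k)
uu-lastVisit acc m k = begin
  dist (suc m) (L.run acc nothing 0) k
    ≡⟨ ∑Word-cong (suc m) split ⟩
  ∑Word (suc m) (λ w → coeff k (P w) + ∑< (suc m) (λ j → coeff k (L.run L.accept₀ nothing 0 (take (suc j) w) ⊕ P (drop (suc j) w))))
    ≡⟨ ∑Word-+ (suc m) (λ w → coeff k (P w)) (λ w → ∑< (suc m) (λ j → coeff k (L.run L.accept₀ nothing 0 (take (suc j) w) ⊕ P (drop (suc j) w)))) ⟩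
  dist (suc m) P k + ∑Word (suc m) (λ w → ∑< (suc m) (λ j → coeff k (L.run L.accept₀ nothing 0 (take (suc j) w) ⊕ P (drop (suc j) w))))
    ≡⟨ cong₂ _+_ (sym (⋆-identityˡ (dist (suc m) P) k))
                 (∑Word-∑< (suc m) (suc m) (λ j w → coeff k (L.run L.accept₀ nothing 0 (take (suc j) w) ⊕ P (drop (suc j) w)))) ⟩
  (uu 0 ⋆ dist (suc m) P) k + ∑< (suc m) (λ j → ∑Word (suc m) (λ w → coeff k (L.run L.accept₀ nothing 0 (take (suc j) w) ⊕ P (drop (suc j) w))))
    ≡⟨ cong ((uu 0 ⋆ dist (suc m) P) k +_) (∑<-cong (suc m) (λ j j<1+m → dist-split (suc m) (suc j) (L.run L.accept₀ nothing 0) P j<1+m k)) ⟩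
  (uu 0 ⋆ dist (suc m) P) k + ∑< (suc m) (λ j → (uu (suc j) ⋆ dist (m ∸ j) P) k)
    ≡⟨ sym (∑<-head (suc m) (λ i → (uu i ⋆ dist (suc m ∸ i) P) k)) ⟩
  ∑< (suc m) (λ i → (uu i ⋆ dist (suc m ∸ i) P) k) + (uu (suc m) ⋆ dist (m ∸ m) P) k
    ≡⟨ cong (∑< (suc m) (λ i → (uu i ⋆ dist (suc m ∸ i) P) k) +_) (trans (cong (λ l → (uu (suc m) ⋆ dist l P) k) (n∸n≡0 m)) (⋆-zeroʳ (uu (suc m)) (λ _ → refl) k)) ⟩
  ∑< (suc m) (λ i → (uu i ⋆ dist (suc m ∸ i) P) k) + 0
    ≡⟨ +-identityʳ _ ⟩
  ∑< (suc m) (λ i → (uu i ⋆ dist (suc m ∸ i) P) k) ∎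
  where
  P : Word → Maybe ℕ
  P = L.firstPassage acc nothing 0
  split : ∀ w → length w ≡ suc m →
    coeff k (L.run acc nothing 0 w) ≡ coeff k (P w) + ∑< (suc m) (λ j → coeff k (L.run L.accept₀ nothing 0 (take (suc j) w) ⊕ P (drop (suc j) w)))
  split (b ∷ w) refl = begin
    coeff k (L.run acc nothing 0 (b ∷ w))
      ≡⟨ sym (coeff-0⊕ k (L.run acc nothing 0 (b ∷ w))) ⟩
    coeff k (just 0 ⊕ L.run acc nothing 0 (b ∷ w))
      ≡⟨ L.run-split-lastVisit acc (L-firstPassage-prev acc) nothing 0 0 k b w ⟩
    coeff k (just 0 ⊕ P (b ∷ w)) + ∑< (suc (length w)) (λ j → coeff k (just 0 ⊕ L.run L.accept₀ nothing 0 (b ∷ take j w) ⊕ P (drop j w)))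
      ≡⟨ cong₂ _+_ (coeff-0⊕ k (P (b ∷ w)))
                   (∑<-cong (suc (length w)) (λ j _ → coeff-0⊕ k (L.run L.accept₀ nothing 0 (b ∷ take j w) ⊕ P (drop j w)))) ⟩
    coeff k (P (b ∷ w)) + ∑< (suc (length w)) (λ j → coeff k (L.run L.accept₀ nothing 0 (b ∷ take j w) ⊕ P (drop j w))) ∎

-- A prime of length at least 2 starts with U, and the rest is a first passage from height 1.
uuPrime-afterU : ∀ acc m → dist (suc (suc m)) (L.firstPassage acc nothing 0) ≗ dist m (L.run (L.appendD acc) (just U) 0)
uuPrime-afterU acc m k = begin
  ∑Word (suc m) (λ w → coeff k (just 0 ⊕ L.firstPassage acc (just U) 1 w))
    + ∑Word (suc m) (λ w → coeff k (just 0 ⊕ L.atEnd acc (just F) w)) + ∑Word (suc m) (λ _ → 0)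
    ≡⟨ cong₂ _+_ (cong₂ _+_ (∑Word-cong′ (suc m) (λ w → coeff-0⊕ k (L.firstPassage acc (just U) 1 w)))
                            (cong₂ _+_ (cong₂ _+_ (∑Word-zero m) (∑Word-zero m)) (∑Word-zero m)))
                 (∑Word-zero (suc m)) ⟩
  dist (suc m) (L.firstPassage acc (just U) 1) k + 0 + 0
    ≡⟨ trans (+-identityʳ _) (+-identityʳ _) ⟩
  dist (suc m) (L.firstPassage acc (just U) 1) k
    ≡⟨ L.dist-firstPassage acc (just U) 0 m k ⟩
  dist m (L.run (L.appendD acc) (just U) 0) k ∎

-- After U at height 0 the only admissible step is F, after which the previous step no longer matters.
uu-afterU : ∀ acc → acc (just F) ≡ acc nothing → ∀ m →
  dist (suc m) (L.run acc (just U) 0) ≗ dist m (L.run acc nothing 0)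
uu-afterU acc eq m k = begin
  ∑Word m (λ _ → 0) + ∑Word m (λ u → coeff k (just 0 ⊕ L.run acc (just F) 0 u)) + ∑Word m (λ _ → 0)
    ≡⟨ cong₂ _+_ (cong₂ _+_ (∑Word-zero m)
                            (∑Word-cong′ m (λ u → trans (coeff-0⊕ k (L.run acc (just F) 0 u)) (cong (coeff k) (L-run-afterF acc eq u)))))
                 (∑Word-zero m) ⟩
  0 + dist m (L.run acc nothing 0) k + 0
    ≡⟨ +-identityʳ _ ⟩
  dist m (L.run acc nothing 0) k ∎

uuPrime-1 : uuPrime 1 ≗ δ 0
uuPrime-1 k = +-identityʳ (δ 0 k)

uuPrime-2 : uuPrime 2 ≗ δ 0
uuPrime-2 = uuPrime-afterU L.accept₀ 0

uuPrime-3+ : ∀ m → uuPrime (3 + m) ≗ uuD m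
uuPrime-3+ m k = trans (uuPrime-afterU L.accept₀ (suc m) k) (uu-afterU (L.appendD L.accept₀) refl m k)

uuPrimeD-1 : uuPrimeD 1 ≗ δ 0
uuPrimeD-1 k = +-identityʳ (δ 0 k)

uuPrimeD-2 : uuPrimeD 2 ≗ shift (δ 0)
uuPrimeD-2 zero    = uuPrime-afterU (L.appendD L.accept₀) 0 zero
uuPrimeD-2 (suc k) = uuPrime-afterU (L.appendD L.accept₀) 0 (suc k)

-- The second appended D creates one more occurrence of DD.
uuPrimeD-3+ : ∀ m → uuPrimeD (3 + m) ≗ shift (uuD m)
uuPrimeD-3+ m k = begin
  uuPrimeD (3 + m) k
    ≡⟨ uuPrime-afterU (L.appendD L.accept₀) (suc m) k ⟩
  dist (suc m) (L.run (L.appendD (L.appendD L.accept₀)) (just U) 0) k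
    ≡⟨ dist-cong (suc m) (L.run-cong appendD-twice (just U) 0) k ⟩
  dist (suc m) (L.run (λ q → L.appendD L.accept₀ q ⊕ just 1) (just U) 0) k
    ≡⟨ uu-afterU (λ q → L.appendD L.accept₀ q ⊕ just 1) refl m k ⟩
  dist m (L.run (λ q → L.appendD L.accept₀ q ⊕ just 1) nothing 0) k
    ≡⟨ ∑Word-cong′ m (λ u → cong (coeff k) (trans (L.run-⊕ʳ (L.appendD L.accept₀) 1 nothing 0 u) (⊕-comm _ (just 1)))) ⟩
  ∑Word m (λ u → coeff k (just 1 ⊕ L.run (L.appendD L.accept₀) nothing 0 u))
    ≡⟨ ∑Word-cong′ m (λ u → coeff-1⊕ (L.run (L.appendD L.accept₀) nothing 0 u) k) ⟩
  ∑Word m (λ u → shift (λ j → coeff j (L.run (L.appendD L.accept₀) nothing 0 u)) k)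
    ≡⟨ shift-∑Word k ⟩
  shift (uuD m) k ∎
  where
  appendD-twice : ∀ q → L.appendD (L.appendD L.accept₀) q ≡ L.appendD L.accept₀ q ⊕ just 1
  appendD-twice nothing  = refl
  appendD-twice (just U) = refl
  appendD-twice (just F) = refl
  appendD-twice (just D) = refl
  shift-∑Word : ∀ k → ∑Word m (λ u → shift (λ j → coeff j (L.run (L.appendD L.accept₀) nothing 0 u)) k) ≡ shift (uuD m) k
  shift-∑Word zero    = ∑Word-zero m
  shift-∑Word (suc k) = refl

ud udAfterD udFrom1 udDescent : ℕ → ℕ → ℕ
ud        n = dist n (R.run R.accept₀ nothing 0)
udAfterD  n = dist n (R.run R.accept₀ (just D) 0)
udFrom1   n = dist n (R.run R.accept₀ (just U) 1)
udDescent n = dist n (R.firstPassage R.accept₀ (just U) 1)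

R-run-afterF : ∀ w → R.run R.accept₀ (just F) 0 w ≡ R.run R.accept₀ nothing 0 w
R-run-afterF []      = refl
R-run-afterF (U ∷ w) = refl
R-run-afterF (F ∷ w) = refl
R-run-afterF (D ∷ w) = refl

ud-suc : ∀ n → ud (suc n) ≗ λ k → udFrom1 n k + ud n k
ud-suc n k = begin
  ∑Word n (λ w → coeff k (just 0 ⊕ R.run R.accept₀ (just U) 1 w))
    + ∑Word n (λ w → coeff k (just 0 ⊕ R.run R.accept₀ (just F) 0 w)) + ∑Word n (λ _ → 0)
    ≡⟨ cong₂ _+_ (cong₂ _+_ (∑Word-cong′ n (λ w → coeff-0⊕ k (R.run R.accept₀ (just U) 1 w)))
                            (∑Word-cong′ n (λ w → trans (coeff-0⊕ k (R.run R.accept₀ (just F) 0 w)) (cong (coeff k) (R-run-afterF w)))))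
                 (∑Word-zero n) ⟩
  udFrom1 n k + ud n k + 0 ≡⟨ +-identityʳ _ ⟩
  udFrom1 n k + ud n k ∎

-- After a D, a first step U creates an occurrence of DU.
udAfterD-suc : ∀ n → udAfterD (suc n) ≗ λ k → shift (udFrom1 n) k + ud n k
udAfterD-suc n k = begin
  ∑Word n (λ w → coeff k (just 1 ⊕ R.run R.accept₀ (just U) 1 w))
    + ∑Word n (λ w → coeff k (just 0 ⊕ R.run R.accept₀ (just F) 0 w)) + ∑Word n (λ _ → 0)
    ≡⟨ cong₂ _+_ (cong₂ _+_ (shifted k)
                            (∑Word-cong′ n (λ w → trans (coeff-0⊕ k (R.run R.accept₀ (just F) 0 w)) (cong (coeff k) (R-run-afterF w)))))
                 (∑Word-zero n) ⟩
  shift (udFrom1 n) k + ud n k + 0 ≡⟨ +-identityʳ _ ⟩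
  shift (udFrom1 n) k + ud n k ∎
  where
  shifted : ∀ k → ∑Word n (λ w → coeff k (just 1 ⊕ R.run R.accept₀ (just U) 1 w)) ≡ shift (udFrom1 n) k
  shifted zero    = trans (∑Word-cong′ n (λ w → coeff-1⊕ (R.run R.accept₀ (just U) 1 w) 0)) (∑Word-zero n)
  shifted (suc k) = ∑Word-cong′ n (λ w → coeff-1⊕ (R.run R.accept₀ (just U) 1 w) (suc k))

udFrom1-firstReturn : ∀ n → udFrom1 n ≗ λ k → ∑< (suc n) (λ i → (udDescent i ⋆ udAfterD (n ∸ i)) k)
udFrom1-firstReturn n k = begin
  udFrom1 n k
    ≡⟨ ∑Word-cong n split ⟩
  ∑Word n (λ w → ∑< (suc n) (λ i → coeff k (R.firstPassage R.accept₀ (just U) 1 (take i w) ⊕ R.run R.accept₀ (just D) 0 (drop i w))))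
    ≡⟨ ∑Word-∑< n (suc n) (λ i w → coeff k (R.firstPassage R.accept₀ (just U) 1 (take i w) ⊕ R.run R.accept₀ (just D) 0 (drop i w))) ⟩
  ∑< (suc n) (λ i → ∑Word n (λ w → coeff k (R.firstPassage R.accept₀ (just U) 1 (take i w) ⊕ R.run R.accept₀ (just D) 0 (drop i w))))
    ≡⟨ ∑<-cong (suc n) (λ i i<1+n → dist-split n i (R.firstPassage R.accept₀ (just U) 1) (R.run R.accept₀ (just D) 0) (≤-pred i<1+n) k) ⟩
  ∑< (suc n) (λ i → (udDescent i ⋆ udAfterD (n ∸ i)) k) ∎
  where
  split : ∀ w → length w ≡ n → coeff k (R.run R.accept₀ (just U) 1 w)
            ≡ ∑< (suc n) (λ i → coeff k (R.firstPassage R.accept₀ (just U) 1 (take i w) ⊕ R.run R.accept₀ (just D) 0 (drop i w)))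
  split w refl = begin
    coeff k (R.run R.accept₀ (just U) 1 w)
      ≡⟨ sym (coeff-0⊕ k (R.run R.accept₀ (just U) 1 w)) ⟩
    coeff k (just 0 ⊕ R.run R.accept₀ (just U) 1 w)
      ≡⟨ R.run-split-firstPassage R.accept₀ (just U) 0 0 k w ⟩
    ∑< (suc (length w)) (λ i → coeff k (just 0 ⊕ R.firstPassage R.accept₀ (just U) 1 (take i w) ⊕ R.run R.accept₀ (just D) 0 (drop i w)))
      ≡⟨ ∑<-cong (suc (length w)) (λ i _ → coeff-0⊕ k (R.firstPassage R.accept₀ (just U) 1 (take i w) ⊕ R.run R.accept₀ (just D) 0 (drop i w))) ⟩
    ∑< (suc (length w)) (λ i → coeff k (R.firstPassage R.accept₀ (just U) 1 (take i w) ⊕ R.run R.accept₀ (just D) 0 (drop i w))) ∎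

-- The appended D is forbidden only right after U, which cannot happen at height 0 unless we start there.
R-run-appendD : ∀ q h u → ¬ (h ≡ 0 × q ≡ just U) → R.run (R.appendD R.accept₀) q h u ≡ R.run R.accept₀ q h u
R-run-appendD nothing  zero    [] _   = refl
R-run-appendD (just U) zero    [] ¬UU = ⊥-elim (¬UU (refl , refl))
R-run-appendD (just F) zero    [] _   = refl
R-run-appendD (just D) zero    [] _   = refl
R-run-appendD q        (suc h) [] _   = refl
R-run-appendD q        h       (b ∷ u) ¬UU with R.transition q h b in eq
... | nothing       = refl
... | just (h′ , d) = cong (just d ⊕_) (R-run-appendD (just b) h′ u ¬UU′)
  where
  ¬UU′ : ¬ (h′ ≡ 0 × just b ≡ just U)
  ¬UU′ (refl , refl) = R.transition-to-0-notU {q} {h} {U} eq refl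

udDescent-1 : udDescent 1 ≗ λ _ → 0
udDescent-1 = R.dist-firstPassage R.accept₀ (just U) 0 0

udDescent-2+ : ∀ m → udDescent (2 + m) ≗ ud (suc m)
udDescent-2+ m k = trans (R.dist-firstPassage R.accept₀ (just U) 0 (suc m) k)
  (cong₂ _+_ (cong₂ _+_ (∑Word-cong′ m (λ u → cong (λ x → coeff k (just 0 ⊕ x)) (R-run-appendD (just U) 1 u λ { (() , _) })))
                        (∑Word-cong′ m (λ u → cong (λ x → coeff k (just 0 ⊕ x)) (R-run-appendD (just F) 0 u λ { (_ , ()) }))))
             refl)

udFrom1-suc : ∀ m → udFrom1 (suc m) ≗ λ k → ∑< m (λ i → (ud (suc i) ⋆ udAfterD (m ∸ suc i)) k)
udFrom1-suc m k = begin
  udFrom1 (suc m) k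
    ≡⟨ udFrom1-firstReturn (suc m) k ⟩
  ∑< (suc (suc m)) (λ i → (udDescent i ⋆ udAfterD (suc m ∸ i)) k)
    ≡⟨ ∑<-head (suc m) _ ⟩
  (udDescent 0 ⋆ udAfterD (suc m)) k + ∑< (suc m) (λ i → (udDescent (suc i) ⋆ udAfterD (m ∸ i)) k)
    ≡⟨ cong₂ _+_ (⋆-zeroˡ (udAfterD (suc m)) (λ _ → refl) k) (∑<-head m _) ⟩
  0 + ((udDescent 1 ⋆ udAfterD m) k + ∑< m (λ i → (udDescent (2 + i) ⋆ udAfterD (m ∸ suc i)) k))
    ≡⟨ cong₂ _+_ (⋆-zeroˡ (udAfterD m) udDescent-1 k)
                 (∑<-cong m (λ i _ → ⋆-cong {Q = udAfterD (m ∸ suc i)} (udDescent-2+ i) (λ _ → refl) k)) ⟩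
  ∑< m (λ i → (ud (suc i) ⋆ udAfterD (m ∸ suc i)) k) ∎

shift-∑< : ∀ m (P Q : ℕ → ℕ → ℕ) k →
  ∑< m (λ i → (P i ⋆ shift (Q i)) k) ≡ shift (λ k → ∑< m (λ i → (P i ⋆ Q i) k)) k
shift-∑< m P Q zero    = ∑<-zero m (λ i _ → ⋆-shiftʳ (P i) (Q i) 0)
shift-∑< m P Q (suc k) = ∑<-cong m (λ i _ → ⋆-shiftʳ (P i) (Q i) (suc k))

∑<-uu⋆≡∑<-ud⋆ : ∀ m {P Q : ℕ → ℕ → ℕ} →
  (∀ i → i < m → uu i ≗ ud (suc i)) → (∀ l → l < m → P (2 + l) ≗ Q l) → ∀ k →
  ∑< m (λ i → (uu i ⋆ P (suc m ∸ i)) k) ≡ ∑< m (λ i → (ud (suc i) ⋆ Q (m ∸ suc i)) k)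
∑<-uu⋆≡∑<-ud⋆ m {P} uu≗ P≗Q k = ∑<-cong m (λ i i<m → trans
  (cong (λ l → (uu i ⋆ P l) k) (suc∸ i<m))
  (⋆-cong (uu≗ i i<m) (P≗Q (m ∸ suc i) (∸-monoʳ-< (s≤s z≤n) i<m)) k))
  where
  suc∸ : ∀ {m i} → i < m → suc m ∸ i ≡ 2 + (m ∸ suc i)
  suc∸ {suc m} {zero}  _         = refl
  suc∸ {suc m} {suc i} (s≤s i<m) = suc∸ i<m

uu⋆-last : ∀ m (P : ℕ → ℕ → ℕ) → P 1 ≗ δ 0 → ∀ k → (uu m ⋆ P (suc m ∸ m)) k ≡ uu m k
uu⋆-last m P P1≗δ0 k = trans (cong (λ l → (uu m ⋆ P l) k) (m+n∸n≡m 1 m)) (trans (⋆-cong {P = uu m} (λ _ → refl) P1≗δ0 k) (⋆-identityʳ (uu m) k))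

uu-suc≗ : ∀ m → (∀ i → i ≤ m → uu i ≗ ud (suc i)) → (∀ l → l < m → uuPrime (2 + l) ≗ udAfterD l) →
  uu (suc m) ≗ ud (2 + m)
uu-suc≗ m uu≗ uuPrime≗ k = begin
  uu (suc m) k
    ≡⟨ uu-lastVisit L.accept₀ m k ⟩
  ∑< m (λ i → (uu i ⋆ uuPrime (suc m ∸ i)) k) + (uu m ⋆ uuPrime (suc m ∸ m)) k
    ≡⟨ cong₂ _+_ (∑<-uu⋆≡∑<-ud⋆ m {uuPrime} {udAfterD} (λ i i<m → uu≗ i (<⇒≤ i<m)) uuPrime≗ k)
                 (trans (uu⋆-last m uuPrime uuPrime-1 k) (uu≗ m ≤-refl k)) ⟩
  ∑< m (λ i → (ud (suc i) ⋆ udAfterD (m ∸ suc i)) k) + ud (suc m) k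
    ≡⟨ cong (_+ ud (suc m) k) (sym (udFrom1-suc m k)) ⟩
  udFrom1 (suc m) k + ud (suc m) k
    ≡⟨ sym (ud-suc (suc m) k) ⟩
  ud (2 + m) k ∎

uuD-suc≗ : ∀ m → (∀ i → i ≤ m → uu i ≗ ud (suc i)) → (∀ l → l < m → uuPrimeD (2 + l) ≗ shift (udAfterD l)) →
  uuD (suc m) ≗ udAfterD (2 + m)
uuD-suc≗ m uu≗ uuPrimeD≗ k = begin
  uuD (suc m) k
    ≡⟨ uu-lastVisit (L.appendD L.accept₀) m k ⟩
  ∑< m (λ i → (uu i ⋆ uuPrimeD (suc m ∸ i)) k) + (uu m ⋆ uuPrimeD (suc m ∸ m)) k
    ≡⟨ cong₂ _+_ (∑<-uu⋆≡∑<-ud⋆ m {uuPrimeD} {λ l → shift (udAfterD l)} (λ i i<m → uu≗ i (<⇒≤ i<m)) uuPrimeD≗ k)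
                 (trans (uu⋆-last m uuPrimeD uuPrimeD-1 k) (uu≗ m ≤-refl k)) ⟩
  ∑< m (λ i → (ud (suc i) ⋆ shift (udAfterD (m ∸ suc i))) k) + ud (suc m) k
    ≡⟨ cong (_+ ud (suc m) k) (shift-∑< m (λ i → ud (suc i)) (λ i → udAfterD (m ∸ suc i)) k) ⟩
  shift (λ k → ∑< m (λ i → (ud (suc i) ⋆ udAfterD (m ∸ suc i)) k)) k + ud (suc m) k
    ≡⟨ cong (_+ ud (suc m) k) (shift-cong (λ k → sym (udFrom1-suc m k)) k) ⟩
  shift (udFrom1 (suc m)) k + ud (suc m) k
    ≡⟨ sym (udAfterD-suc (suc m) k) ⟩
  udAfterD (2 + m) k ∎

uu≗ud : ∀ m → (uu m ≗ ud (suc m)) × (uuD m ≗ udAfterD (suc m))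
uu≗ud = <-rec _ step
  where
  step : ∀ m → (∀ {i} → i < m → (uu i ≗ ud (suc i)) × (uuD i ≗ udAfterD (suc i))) →
    (uu m ≗ ud (suc m)) × (uuD m ≗ udAfterD (suc m))
  step zero    _  = (λ k → sym (+-identityʳ (δ 0 k))) , (λ k → sym (+-identityʳ (δ 0 k)))
  step (suc m) ih = uu-suc≗ m uu≗ uuPrime≗ , uuD-suc≗ m uu≗ uuPrimeD≗
    where
    uu≗ : ∀ i → i ≤ m → uu i ≗ ud (suc i)
    uu≗ i i≤m = proj₁ (ih (s≤s i≤m))

    uuD≗ : ∀ l → suc l < m → uuD l ≗ udAfterD (suc l)
    uuD≗ l 1+l<m = proj₂ (ih (<-trans (n<1+n l) (m<n⇒m<1+n 1+l<m)))

    uuPrime≗ : ∀ l → l < m → uuPrime (2 + l) ≗ udAfterD l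
    uuPrime≗ zero    _     = uuPrime-2
    uuPrime≗ (suc l) 1+l<m = λ k → trans (uuPrime-3+ l k) (uuD≗ l 1+l<m k)

    uuPrimeD≗ : ∀ l → l < m → uuPrimeD (2 + l) ≗ shift (udAfterD l)
    uuPrimeD≗ zero    _     = uuPrimeD-2
    uuPrimeD≗ (suc l) 1+l<m = λ k → trans (uuPrimeD-3+ l k) (shift-cong (uuD≗ l 1+l<m) k)

isZero≡==ℕ0 : ∀ n → isZero n ≡ (n ==ℕ 0)
isZero≡==ℕ0 zero    = refl
isZero≡==ℕ0 (suc n) = refl

mainTheorem2 : (∀ (n k : ℕ) →
      countM n (λ p → isZero (occ (U ∷ U ∷ []) p) ∧ (occ (D ∷ D ∷ []) p ==ℕ k))
        ≡ countM (suc n) (λ p → isZero (occ (U ∷ D ∷ []) p) ∧ (occ (D ∷ U ∷ []) p ==ℕ k)))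
    × (∀ (n : ℕ) →
      countM n (λ p → isZero (occ (U ∷ U ∷ []) p) ∧ isZero (occ (D ∷ D ∷ []) p))
        ≡ countM (suc n) (λ p → isZero (occ (U ∷ D ∷ []) p) ∧ isZero (occ (D ∷ U ∷ []) p)))
mainTheorem2 = byStatistic , avoidingBoth
  where
  byStatistic : ∀ n k →
    countM n (λ p → isZero (occ (U ∷ U ∷ []) p) ∧ (occ (D ∷ D ∷ []) p ==ℕ k))
      ≡ countM (suc n) (λ p → isZero (occ (U ∷ D ∷ []) p) ∧ (occ (D ∷ U ∷ []) p ==ℕ k))
  byStatistic n k = begin
    countM n (λ p → isZero (occ (U ∷ U ∷ []) p) ∧ (occ (D ∷ D ∷ []) p ==ℕ k)) ≡⟨ L.countM-dist n k ⟩
    uu n k                                                                     ≡⟨ proj₁ (uu≗ud n) k ⟩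
    ud (suc n) k                                                               ≡⟨ sym (R.countM-dist (suc n) k) ⟩
    countM (suc n) (λ p → isZero (occ (U ∷ D ∷ []) p) ∧ (occ (D ∷ U ∷ []) p ==ℕ k)) ∎

  avoidingBoth : ∀ n →
    countM n (λ p → isZero (occ (U ∷ U ∷ []) p) ∧ isZero (occ (D ∷ D ∷ []) p))
      ≡ countM (suc n) (λ p → isZero (occ (U ∷ D ∷ []) p) ∧ isZero (occ (D ∷ U ∷ []) p))
  avoidingBoth n = begin
    countM n (λ p → isZero (occ (U ∷ U ∷ []) p) ∧ isZero (occ (D ∷ D ∷ []) p))
      ≡⟨ countM-cong n (λ p → cong (isZero (occ (U ∷ U ∷ []) p) ∧_) (isZero≡==ℕ0 (occ (D ∷ D ∷ []) p))) ⟩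
    countM n (λ p → isZero (occ (U ∷ U ∷ []) p) ∧ (occ (D ∷ D ∷ []) p ==ℕ 0))
      ≡⟨ byStatistic n 0 ⟩
    countM (suc n) (λ p → isZero (occ (U ∷ D ∷ []) p) ∧ (occ (D ∷ U ∷ []) p ==ℕ 0))
      ≡⟨ countM-cong (suc n) (λ p → cong (isZero (occ (U ∷ D ∷ []) p) ∧_) (sym (isZero≡==ℕ0 (occ (D ∷ U ∷ []) p)))) ⟩
    countM (suc n) (λ p → isZero (occ (U ∷ D ∷ []) p) ∧ isZero (occ (D ∷ U ∷ []) p)) ∎
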